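{- Let $X\subseteq V$, $k>0$, and $\mathbf{r}\in\mathbb{N}^k$. For $1\leq j\leq \ell$ let $\mathbf{t}_j=(t_{i,j})_{i=1}^k\in \mathbb{M}^k$, and suppose that $t_{k,j}<t_{1,j+1}$ for each $j=1,\ldots,\ell-1$. If $X$ contains no balanced $(k,\mathbf{t}_j,\mathbf{r})$-stars for each $1\leq j\leq \ell$ then for all $n>t_{k,\ell}$ we have $$ \frac{|X\cap S_n|}{|S_n|}<(q^{ -\ell}+rq^{1-t_{1,1}}), $$ where $r=\max\{r_i\mid 1\leq i\leq k\}$.
   Context: Let $T_q$ be the homogeneous tree of degree $q+1\geq 3$ with vertex set $V$, graph metric $d$, and fixed root $o\in V$; $S_n=\{y\in V\mid d(o,y)=n\}$. $\mathbb{M}^k$ is the set of strictly increasing sequences of $k$ positive integers. For $\mathbf{t}=(t_i)\in\mathbb{M}^k$, $\mathbf{r}=(r_i)\in\mathbb{N}^k$, a $(k,\mathbf{t},\mathbf{r})$-star is a vertex set $Y$ with centre $v_0\in Y$ such that every $v\in Y$ has $d(v_0,v)\in\{2t_1,\ldots,2t_k\}$ and exactly $r_i$ vertices $v\in Y$ have $d(v_0,v)=2t_i$; it is balanced if $d(o,\cdot)$ is constant on $Y$. -}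

module Defs where

open import Data.Nat using (ℕ; zero; suc; _+_; _*_; _∸_; _<_; _⊔_)
open import Data.Nat.Properties using (_≟_)
open import Data.Fin using (Fin; zero; suc)
import Data.Fin.Properties as FinP
open import Data.List using (List; []; _∷_; length; filter)
open import Data.List.Relation.Unary.All using (All)
open import Data.List.Membership.Propositional using (_∈_)
open import Data.List.Relation.Unary.Unique.Propositional using (Unique)
open import Data.Vec using (Vec; []; _∷_; toList)
open import Data.Bool using (Bool; true; false; if_then_else_)
open import Data.Product using (∃)
open import Relation.Nullary using (¬_; yes; no)
open import Relation.Binary.PropositionalEquality using (_≡_; _≢_)

-- The homogeneous tree T_q of degree q+1, rooted at o = root.
-- A vertex at distance m+1 from the root is 'node a w': the root has the
-- q+1 children 'node a []' (a : Fin (q+1)), and every non-root vertex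
-- 'node a w' has the q children 'node a (w ++ [b])' (b : Fin q); its
-- parent is obtained by deleting the last letter.
data V (q : ℕ) : Set where
  root : V q
  node : Fin (suc q) → List (Fin q) → V q

commonPrefix : ∀ {q} → List (Fin q) → List (Fin q) → ℕ
commonPrefix [] _ = 0
commonPrefix (_ ∷ _) [] = 0
commonPrefix (x ∷ xs) (y ∷ ys) with x FinP.≟ y
... | yes _ = suc (commonPrefix xs ys)
... | no _  = 0

confluent : ∀ {q} → V q → V q → ℕ
confluent root _ = 0
confluent (node _ _) root = 0
confluent (node a w) (node b u) with a FinP.≟ b
... | yes _ = suc (commonPrefix w u)
... | no _  = 0

depth : ∀ {q} → V q → ℕ
depth root = 0
depth (node _ w) = suc (length w)

-- graph metric of the tree: length of the unique geodesic x — x∧y — y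
d : ∀ {q} → V q → V q → ℕ
d x y = depth x + depth y ∸ 2 * confluent x y

sumFin : ∀ {m} → (Fin m → ℕ) → ℕ
sumFin {zero} f = 0
sumFin {suc m} f = f zero + sumFin (λ i → f (suc i))

maxFin : ∀ {m} → (Fin m → ℕ) → ℕ
maxFin {zero} f = 0
maxFin {suc m} f = f zero ⊔ maxFin (λ i → f (suc i))

countWords : ∀ {q} (m : ℕ) → (List (Fin q) → Bool) → ℕ
countWords {q} zero P = if P [] then 1 else 0
countWords {q} (suc m) P = sumFin (λ b → countWords m (λ w → P (b ∷ w)))

-- |X ∩ S_n| for X ⊆ V given by its characteristic function
sphereCount : ∀ {q} → (V q → Bool) → ℕ → ℕ
sphereCount X zero = if X root then 1 else 0
sphereCount X (suc m) = sumFin (λ a → countWords m (λ w → X (node a w)))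

sphereSize : (q : ℕ) → ℕ → ℕ
sphereSize q n = sphereCount {q} (λ _ → true) n

InM : ∀ {k} → (Fin k → ℕ) → Set
InM {k} t = (∀ i → 0 < t i) × (∀ (i j : Fin k) → Data.Fin._<_ i j → t i < t j)
  where open import Data.Product using (_×_)
        import Data.Fin

-- Y (a finite vertex set, given as a duplicate-free list) is a
-- (k,t,r)-star with centre v0 ∈ Y
record IsStar {q k : ℕ} (t r : Fin k → ℕ) (v0 : V q) (Y : List (V q)) : Set where
  field
    centre∈ : v0 ∈ Y
    unique  : Unique Y
    dists   : ∀ v → v ∈ Y → v ≢ v0 → ∃ λ i → d v0 v ≡ 2 * t i
    counts  : ∀ i → length (filter (λ v → d v0 v ≟ 2 * t i) Y) ≡ r i

Balanced : ∀ {q} → List (V q) → Set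
Balanced {q} [] = Data.Unit.⊤ where import Data.Unit
Balanced {q} (v ∷ Y) = All (λ u → d root u ≡ d root v) Y

ContainsBalancedStar : ∀ {q k} → (V q → Bool) → (t r : Fin k → ℕ) → Set
ContainsBalancedStar {q} X t r =
  ∃ λ (v0 : V q) → ∃ λ (Y : List (V q)) →
    IsStar t r v0 Y × Balanced Y × All (λ v → X v ≡ true) Y
  where open import Data.Product using (_×_)

-- Work in the branch below one child a of the root, the vertices of S_n there being the
-- words w of length m = n - 1.  Take w ∈ X and a scale t = tᵢ; cut w as A ++ b ∷ s with
-- |b ∷ s| = t.  The vertices of S_n at distance 2t from w are exactly the descendants of A
-- avoiding the child A ∷ʳ b, so if X contains no balanced star then for some i fewer than rᵢ
-- of them lie in X: the subtree of A then carries at most r - 1 more X-leaves than the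
-- subtree of one of its children.  An induction over the scales t₁ < ... < t_k turns a
-- density bound δ, valid from some height below t₁ on, into δ / q + (r - 1) q^(-t₁) from
-- height t_k on.  Running the ℓ scale sequences one after the other (t_{1,j} ≥ t_{1,1} + j - 1
-- by the chain condition) from δ = 1 gives density at most q^(-ℓ) + (r - 1) q^(1 - t_{1,1}).

module Submission where

open import Defs
open import Data.Nat using (ℕ; zero; suc; pred; _+_; _*_; _∸_; _^_; _≤_; _<_; z≤n; s≤s; s≤s⁻¹; NonZero; _<?_; >-nonZero; ≢-nonZero)
open import Data.Nat.Properties
open import Data.Nat.Tactic.RingSolver using (solve-∀)
open import Algebra.Properties.CommutativeSemigroup +-commutativeSemigroup using () renaming (interchange to +-interchange)
open import Data.Fin as Fin using (Fin; zero; suc; toℕ; fromℕ; inject₁)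
import Data.Fin.Properties as FinP
open import Data.Fin.Induction using (<-weakInduction; >-weakInduction)
open import Data.Bool using (Bool; true; false; if_then_else_; _∧_; not)
open import Data.Bool.Properties using (∧-zeroʳ; ∧-identityʳ; ∧-conicalˡ; ∧-conicalʳ; ¬-not)
open import Data.List using (List; []; _∷_; length; _++_; _∷ʳ_; map; concat; tabulate; take; drop; filter)
open import Data.List.Properties
  using (length-++; length-map; length-take; length-drop; take++drop≡id; ++-assoc; ++-cancelˡ; ∷-injective; ∷-injectiveʳ;
         filter-++; filter-all; filter-none; filter-reject)
open import Data.List.Membership.Propositional using (_∈_)
open import Data.List.Membership.Propositional.Properties using (∈-map⁻; ∈-concat⁻′; ∈-tabulate⁻)
open import Data.List.Relation.Unary.Any using (here; there)
open import Data.List.Relation.Unary.All as All using (All; []; _∷_)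
import Data.List.Relation.Unary.All.Properties as AllP
import Data.List.Relation.Unary.AllPairs as AllPairs
import Data.List.Relation.Unary.AllPairs.Properties as AllPairsP
open import Data.List.Relation.Unary.Unique.Propositional using (Unique)
import Data.List.Relation.Unary.Unique.Propositional.Properties as UniqueP
open import Data.Product using (Σ; ∃; _×_; _,_; proj₁)
open import Data.Empty using (⊥-elim)
open import Function using (_∘_; case_of_)
open import Relation.Nullary using (¬_; yes; no; does; Dec)
open import Relation.Nullary.Decidable using (dec-true; dec-false)
open import Relation.Unary using (Decidable)
open import Relation.Binary.PropositionalEquality
open import Relation.Binary using (tri<; tri≈; tri>)

sumFin-cong : ∀ {m} {f g : Fin m → ℕ} → (∀ i → f i ≡ g i) → sumFin f ≡ sumFin g
sumFin-cong {zero}  f≗g = refl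
sumFin-cong {suc m} f≗g = cong₂ _+_ (f≗g zero) (sumFin-cong (f≗g ∘ suc))

sumFin-mono-≤ : ∀ {m} {f g : Fin m → ℕ} → (∀ i → f i ≤ g i) → sumFin f ≤ sumFin g
sumFin-mono-≤ {zero}  f≤g = z≤n
sumFin-mono-≤ {suc m} f≤g = +-mono-≤ (f≤g zero) (sumFin-mono-≤ (f≤g ∘ suc))

sumFin-mono-< : ∀ {m} {f g : Fin (suc m) → ℕ} → (∀ i → f i < g i) → sumFin f < sumFin g
sumFin-mono-< f<g = +-mono-<-≤ (f<g zero) (sumFin-mono-≤ (<⇒≤ ∘ f<g ∘ suc))

sumFin-const : ∀ m c → sumFin {m} (λ _ → c) ≡ m * c
sumFin-const zero    c = refl
sumFin-const (suc m) c = cong (c +_) (sumFin-const m c)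

sumFin-≤-const : ∀ {m} {f : Fin m → ℕ} {c} → (∀ i → f i ≤ c) → sumFin f ≤ m * c
sumFin-≤-const {m} {c = c} f≤c = ≤-trans (sumFin-mono-≤ f≤c) (≤-reflexive (sumFin-const m c))

sumFin-zero : ∀ {m} {f : Fin m → ℕ} → (∀ i → f i ≡ 0) → sumFin f ≡ 0
sumFin-zero {m} f≗0 = trans (sumFin-cong f≗0) (trans (sumFin-const m 0) (*-zeroʳ m))

sumFin-point : ∀ {m} {f : Fin m → ℕ} i → (∀ j → j ≢ i → f j ≡ 0) → sumFin f ≡ f i
sumFin-point {f = f} zero    f≗0 = trans (cong (f zero +_) (sumFin-zero (λ j → f≗0 (suc j) λ ()))) (+-identityʳ _)
sumFin-point {f = f} (suc i) f≗0 =
  trans (cong (_+ sumFin (f ∘ suc)) (f≗0 zero λ ())) (sumFin-point i λ j j≢i → f≗0 (suc j) (j≢i ∘ FinP.suc-injective))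

*-distribʳ-sumFin : ∀ {m} c (f : Fin m → ℕ) → sumFin f * c ≡ sumFin (λ i → f i * c)
*-distribʳ-sumFin {zero}  c f = refl
*-distribʳ-sumFin {suc m} c f =
  trans (*-distribʳ-+ c (f zero) _) (cong (f zero * c +_) (*-distribʳ-sumFin c (f ∘ suc)))

sumFin-distrib-+ : ∀ {m} (f g : Fin m → ℕ) → sumFin (λ i → f i + g i) ≡ sumFin f + sumFin g
sumFin-distrib-+ {zero}  f g = refl
sumFin-distrib-+ {suc m} f g =
  trans (cong (f zero + g zero +_) (sumFin-distrib-+ (f ∘ suc) (g ∘ suc)))
        (+-interchange (f zero) (g zero) _ _)

≤-sumFin : ∀ {m} (f : Fin m → ℕ) i → f i ≤ sumFin f
≤-sumFin f zero    = m≤m+n _ _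
≤-sumFin f (suc i) = ≤-trans (≤-sumFin (f ∘ suc) i) (m≤n+m _ (f zero))

≤-maxFin : ∀ {m} (f : Fin m → ℕ) i → f i ≤ maxFin f
≤-maxFin f zero    = m≤m⊔n _ _
≤-maxFin f (suc i) = ≤-trans (≤-maxFin (f ∘ suc) i) (m≤n⊔m (f zero) _)

module _ {A : Set} where

  length-concat-tabulate : ∀ {m} (f : Fin m → List A) → length (concat (tabulate f)) ≡ sumFin (length ∘ f)
  length-concat-tabulate {zero}  f = refl
  length-concat-tabulate {suc m} f =
    trans (length-++ (f zero)) (cong (length (f zero) +_) (length-concat-tabulate (f ∘ suc)))

  filter-concat-tabulate : ∀ {p} {P : A → Set p} (P? : Decidable P) {m} (f : Fin m → List A) →
                           filter P? (concat (tabulate f)) ≡ concat (tabulate (filter P? ∘ f))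
  filter-concat-tabulate P? {zero}  f = refl
  filter-concat-tabulate P? {suc m} f =
    trans (filter-++ P? (f zero) _) (cong (filter P? (f zero) ++_) (filter-concat-tabulate P? (f ∘ suc)))

  ∈-concat-tabulate⁻ : ∀ {m} (f : Fin m → List A) {x} → x ∈ concat (tabulate f) → ∃ λ i → x ∈ f i
  ∈-concat-tabulate⁻ f x∈ with ∈-concat⁻′ (tabulate f) x∈
  ... | xs , x∈xs , xs∈ with ∈-tabulate⁻ xs∈
  ... | i , refl = i , x∈xs

  concat-tabulate-unique : ∀ {m} (f : Fin m → List A) → (∀ i → Unique (f i)) →
                           (∀ {i j x} → x ∈ f i → x ∈ f j → i ≡ j) → Unique (concat (tabulate f))
  concat-tabulate-unique f unique separated =
    UniqueP.concat⁺ (AllP.tabulate⁺ unique)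
                    (AllPairsP.tabulate⁺ λ i≢j (x∈i , x∈j) → i≢j (separated x∈i x∈j))

module _ {q : ℕ} where

  countWords-cong : ∀ h {P Q : List (Fin q) → Bool} →
                    (∀ s → length s ≡ h → P s ≡ Q s) → countWords h P ≡ countWords h Q
  countWords-cong zero    P≗Q rewrite P≗Q [] refl = refl
  countWords-cong (suc h) P≗Q = sumFin-cong λ b → countWords-cong h λ s ∣s∣ → P≗Q (b ∷ s) (cong suc ∣s∣)

  countWords-none : ∀ h {P : List (Fin q) → Bool} → (∀ s → length s ≡ h → P s ≡ false) → countWords h P ≡ 0
  countWords-none zero    P≗false rewrite P≗false [] refl = refl
  countWords-none (suc h) P≗false = sumFin-zero λ b → countWords-none h λ s ∣s∣ → P≗false (b ∷ s) (cong suc ∣s∣)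

  countWords-all : ∀ h → countWords {q} h (λ _ → true) ≡ q ^ h
  countWords-all zero    = refl
  countWords-all (suc h) = trans (sumFin-cong {q} λ _ → countWords-all h) (sumFin-const q (q ^ h))

  countWords-≤ : ∀ h (P : List (Fin q) → Bool) → countWords h P ≤ q ^ h
  countWords-≤ zero    P with P []
  ... | true  = ≤-refl
  ... | false = z≤n
  countWords-≤ (suc h) P = sumFin-≤-const λ b → countWords-≤ h (λ s → P (b ∷ s))

  countWords-split : ∀ h (P Q : List (Fin q) → Bool) →
                     countWords h P ≡ countWords h (λ s → P s ∧ Q s) + countWords h (λ s → P s ∧ not (Q s))
  countWords-split zero    P Q with P [] | Q []
  ... | true  | true  = refl
  ... | true  | false = refl
  ... | false | _     = refl
  countWords-split (suc h) P Q =
    trans (sumFin-cong λ b → countWords-split h (λ s → P (b ∷ s)) (λ s → Q (b ∷ s)))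
          (sumFin-distrib-+ (λ b → countWords h (λ s → P (b ∷ s) ∧ Q (b ∷ s)))
                            (λ b → countWords h (λ s → P (b ∷ s) ∧ not (Q (b ∷ s)))))

  startsWith : Fin q → List (Fin q) → Bool
  startsWith b []      = false
  startsWith b (c ∷ _) = does (b FinP.≟ c)

  countWords-startsWith : ∀ h b (P : List (Fin q) → Bool) →
                          countWords (suc h) (λ z → P z ∧ startsWith b z) ≡ countWords h (λ s → P (b ∷ s))
  countWords-startsWith h b P =
    trans (sumFin-point b λ c c≢b → countWords-none h λ s _ → off c c≢b s)
          (countWords-cong h λ s _ → trans (cong (P (b ∷ s) ∧_) (dec-true (b FinP.≟ b) refl)) (∧-identityʳ _))
    where
    off : ∀ c → c ≢ b → ∀ s → (P (c ∷ s) ∧ startsWith b (c ∷ s)) ≡ false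
    off c c≢b s rewrite dec-false (b FinP.≟ c) (c≢b ∘ sym) = ∧-zeroʳ (P (c ∷ s))

  words : (h : ℕ) → (List (Fin q) → Bool) → List (List (Fin q))
  words zero    P = if P [] then [] ∷ [] else []
  words (suc h) P = concat (tabulate λ b → map (b ∷_) (words h (λ s → P (b ∷ s))))

  length-words : ∀ h P → length (words h P) ≡ countWords h P
  length-words zero    P with P []
  ... | true  = refl
  ... | false = refl
  length-words (suc h) P =
    trans (length-concat-tabulate λ b → map (b ∷_) (words h (λ s → P (b ∷ s))))
          (sumFin-cong λ b → trans (length-map (b ∷_) (words h (λ s → P (b ∷ s)))) (length-words h (λ s → P (b ∷ s))))

  ∈-words⁻ : ∀ h P {s} → s ∈ words h P → length s ≡ h × P s ≡ true
  ∈-words⁻ zero    P s∈ with P [] in P[]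
  ∈-words⁻ zero    P (here refl) | true = refl , P[]
  ∈-words⁻ (suc h) P s∈ with ∈-concat-tabulate⁻ _ s∈
  ... | b , s∈b with ∈-map⁻ (b ∷_) s∈b
  ... | s′ , s′∈ , refl with ∈-words⁻ h (λ s → P (b ∷ s)) s′∈
  ... | ∣s′∣ , Ps = cong suc ∣s′∣ , Ps

  words-unique : ∀ h P → Unique (words h P)
  words-unique zero    P with P []
  ... | true  = [] AllPairs.∷ AllPairs.[]
  ... | false = AllPairs.[]
  words-unique (suc h) P =
    concat-tabulate-unique _ (λ b → UniqueP.map⁺ ∷-injectiveʳ (words-unique h _)) separated
    where
    separated : ∀ {b c x} → x ∈ map (b ∷_) (words h _) → x ∈ map (c ∷_) (words h _) → b ≡ c
    separated x∈b x∈c with ∈-map⁻ _ x∈b | ∈-map⁻ _ x∈c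
    ... | _ , _ , refl | _ , _ , refl = refl

InM-mono : ∀ {k} {t : Fin k → ℕ} → InM t → ∀ {i j} → i Fin.≤ j → t i ≤ t j
InM-mono (_ , increasing) {i} {j} i≤j with i FinP.≟ j
... | yes refl = ≤-refl
... | no i≢j   = <⇒≤ (increasing i j (FinP.≤∧≢⇒< i≤j i≢j))

InM-injective : ∀ {k} {t : Fin k → ℕ} → InM t → ∀ {i j} → t i ≡ t j → i ≡ j
InM-injective (_ , increasing) {i} {j} tᵢ≡tⱼ with FinP.<-cmp i j
... | tri< i<j _ _ = ⊥-elim (<-irrefl tᵢ≡tⱼ (increasing i j i<j))
... | tri≈ _ i≡j _ = i≡j
... | tri> _ _ j<i = ⊥-elim (<-irrefl (sym tᵢ≡tⱼ) (increasing j i j<i))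

record Fork {A : Set} (w : List A) (t : ℕ) : Set where
  field
    stem   : List A
    branch : A
    tip    : List A
    split  : w ≡ stem ++ branch ∷ tip
    height : t ≡ suc (length tip)

fork : ∀ {A : Set} (w : List A) t → 0 < t → t ≤ length w → Fork w t
fork w zero    ()
fork w (suc h) _ t≤∣w∣ = fromSplit (take n w) (drop n w) (sym (take++drop≡id n w)) ∣drop∣
  where
  n = length w ∸ suc h
  ∣drop∣ : length (drop n w) ≡ suc h
  ∣drop∣ = trans (length-drop n w) (m∸[m∸n]≡n t≤∣w∣)
  fromSplit : ∀ P S → w ≡ P ++ S → length S ≡ suc h → Fork w (suc h)
  fromSplit P (b ∷ S) w≡P++S ∣S∣ =
    record { stem = P ; branch = b ; tip = S ; split = w≡P++S ; height = sym ∣S∣ }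

++-cancel-length : ∀ {A : Set} (xs ys : List A) {us vs : List A} →
                   length xs ≡ length ys → xs ++ us ≡ ys ++ vs → xs ≡ ys
++-cancel-length []       []       _     _  = refl
++-cancel-length (x ∷ xs) (y ∷ ys) ∣xs∣≡ eq with ∷-injective eq
... | refl , eq′ = cong (x ∷_) (++-cancel-length xs ys (suc-injective ∣xs∣≡) eq′)

fork-stem : ∀ {A : Set} {t} (P S : List A) (f : Fork (P ++ S) t) → length S ≡ t → Fork.stem f ≡ P
fork-stem P S f ∣S∣ = ++-cancel-length (Fork.stem f) P ∣stem∣ (sym (Fork.split f))
  where
  open Fork f
  ∣stem∣ : length stem ≡ length P
  ∣stem∣ = +-cancelʳ-≡ (length S) _ _ (begin
    length stem + length S                ≡⟨ cong (length stem +_) (trans ∣S∣ height) ⟩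
    length stem + length (branch ∷ tip)   ≡⟨ length-++ stem ⟨
    length (stem ++ branch ∷ tip)         ≡⟨ cong length split ⟨
    length (P ++ S)                       ≡⟨ length-++ P ⟩
    length P + length S                   ∎)
    where open ≡-Reasoning

module _ {q : ℕ} where

  commonPrefix-self : (w : List (Fin q)) → commonPrefix w w ≡ length w
  commonPrefix-self []      = refl
  commonPrefix-self (x ∷ w) with x FinP.≟ x
  ... | yes _   = cong suc (commonPrefix-self w)
  ... | no x≢x  = ⊥-elim (x≢x refl)

  commonPrefix-fork : ∀ A {b c : Fin q} {s s′} → b ≢ c → commonPrefix (A ++ b ∷ s) (A ++ c ∷ s′) ≡ length A
  commonPrefix-fork []      {b} {c} b≢c with b FinP.≟ c
  ... | yes b≡c = ⊥-elim (b≢c b≡c)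
  ... | no _    = refl
  commonPrefix-fork (x ∷ A) b≢c with x FinP.≟ x
  ... | yes _  = cong suc (commonPrefix-fork A b≢c)
  ... | no x≢x = ⊥-elim (x≢x refl)

  d-node : ∀ (a : Fin (suc q)) x y →
           d (node a x) (node a y) ≡ suc (length x) + suc (length y) ∸ 2 * suc (commonPrefix x y)
  d-node a x y with a FinP.≟ a
  ... | yes _  = refl
  ... | no a≢a = ⊥-elim (a≢a refl)

  d-self : (v : V q) → d v v ≡ 0
  d-self root       = refl
  d-self (node a w) = begin
    d (node a w) (node a w)                         ≡⟨ d-node a w w ⟩
    ℓ + ℓ ∸ 2 * suc (commonPrefix w w)              ≡⟨ cong (λ c → ℓ + ℓ ∸ 2 * suc c) (commonPrefix-self w) ⟩
    ℓ + ℓ ∸ (ℓ + (ℓ + 0))                           ≡⟨ cong (λ c → ℓ + ℓ ∸ (ℓ + c)) (+-identityʳ ℓ) ⟩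
    ℓ + ℓ ∸ (ℓ + ℓ)                                 ≡⟨ n∸n≡0 (ℓ + ℓ) ⟩
    0                                               ∎
    where
    open ≡-Reasoning
    ℓ = suc (length w)

  d-fork : ∀ (a : Fin (suc q)) A {b c s s′} → b ≢ c → length s′ ≡ length s →
           d (node a (A ++ b ∷ s)) (node a (A ++ c ∷ s′)) ≡ 2 * suc (length s)
  d-fork a A {b} {c} {s} {s′} b≢c ∣s′∣ = begin
    d (node a (A ++ b ∷ s)) (node a (A ++ c ∷ s′))
      ≡⟨ d-node a (A ++ b ∷ s) (A ++ c ∷ s′) ⟩
    suc (length (A ++ b ∷ s)) + suc (length (A ++ c ∷ s′)) ∸ 2 * suc (commonPrefix (A ++ b ∷ s) (A ++ c ∷ s′))
      ≡⟨ cong (λ z → suc (length (A ++ b ∷ s)) + suc (length (A ++ c ∷ s′)) ∸ 2 * suc z) (commonPrefix-fork A b≢c) ⟩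
    suc (length (A ++ b ∷ s)) + suc (length (A ++ c ∷ s′)) ∸ 2 * suc x
      ≡⟨ cong₂ (λ u v → suc u + suc v ∸ 2 * suc x)
               (length-++ A) (trans (length-++ A) (cong (λ l → x + suc l) ∣s′∣)) ⟩
    suc (x + y) + suc (x + y) ∸ 2 * suc x
      ≡⟨ cong (_∸ 2 * suc x) (regroup x y) ⟩
    2 * suc x + 2 * y ∸ 2 * suc x
      ≡⟨ m+n∸m≡n (2 * suc x) (2 * y) ⟩
    2 * y ∎
    where
    open ≡-Reasoning
    x = length A
    y = suc (length s)
    regroup : ∀ x y → suc (x + y) + suc (x + y) ≡ 2 * suc x + 2 * y
    regroup = solve-∀

module _ {q k : ℕ} (X : V q → Bool) {t : Fin k → ℕ} (t∈M : InM t) (v₀ : V q) where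

  record Satellite (i : Fin k) (v : V q) : Set where
    field
      distance : d v₀ v ≡ 2 * t i
      level    : d root v ≡ d root v₀
      member   : X v ≡ true

  open Satellite

  balancedStar : ∀ {r} → X v₀ ≡ true → (L : Fin k → List (V q)) → (∀ i → All (Satellite i) (L i)) →
                 (∀ i → Unique (L i)) → (∀ i → length (L i) ≡ r i) → ContainsBalancedStar X t r
  balancedStar {r} v₀∈X L sat unique size = v₀ , v₀ ∷ Z , star , allZ level , v₀∈X ∷ allZ member
    where
    Z = concat (tabulate L)

    allZ : ∀ {P : V q → Set} → (∀ {i v} → Satellite i v → P v) → All P Z
    allZ f = AllP.concat⁺ (AllP.tabulate⁺ λ i → All.map f (sat i))

    satellite : ∀ {i v} → v ∈ L i → Satellite i v
    satellite {i} = All.lookup (sat i)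

    scale-injective : ∀ {i j} → 2 * t i ≡ 2 * t j → i ≡ j
    scale-injective = InM-injective t∈M ∘ *-cancelˡ-≡ _ _ 2

    centre-off : ∀ i → d v₀ v₀ ≢ 2 * t i
    centre-off i eq = <-irrefl (trans (sym (d-self v₀)) eq) (*-monoʳ-< 2 (proj₁ t∈M i))

    separated : ∀ {i j v} → v ∈ L i → v ∈ L j → i ≡ j
    separated v∈i v∈j = scale-injective (trans (sym (distance (satellite v∈i))) (distance (satellite v∈j)))

    dists : ∀ v → v ∈ v₀ ∷ Z → v ≢ v₀ → ∃ λ i → d v₀ v ≡ 2 * t i
    dists v (here v≡v₀) v≢v₀ = ⊥-elim (v≢v₀ v≡v₀)
    dists v (there v∈Z)  _   with ∈-concat-tabulate⁻ L v∈Z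
    ... | i , v∈i = i , distance (satellite v∈i)

    counts : ∀ i → length (filter (λ v → d v₀ v ≟ 2 * t i) (v₀ ∷ Z)) ≡ r i
    counts i = begin
      length (filter at? (v₀ ∷ Z))                   ≡⟨ cong length (filter-reject at? (centre-off i)) ⟩
      length (filter at? Z)                          ≡⟨ cong length (filter-concat-tabulate at? L) ⟩
      length (concat (tabulate (filter at? ∘ L)))    ≡⟨ length-concat-tabulate (filter at? ∘ L) ⟩
      sumFin (length ∘ filter at? ∘ L)               ≡⟨ sumFin-point i (λ j j≢i → cong length (filter-none at? (rejected j≢i))) ⟩
      length (filter at? (L i))                      ≡⟨ cong length (filter-all at? (All.map distance (sat i))) ⟩
      length (L i)                                   ≡⟨ size i ⟩
      r i                                            ∎
      where
      open ≡-Reasoning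
      at? = λ v → d v₀ v ≟ 2 * t i
      rejected : ∀ {j} → j ≢ i → All (λ v → d v₀ v ≢ 2 * t i) (L j)
      rejected j≢i = All.map (λ s eq → j≢i (scale-injective (trans (sym (distance s)) eq))) (sat _)

    star : IsStar t r v₀ (v₀ ∷ Z)
    star = record
      { centre∈ = here refl
      ; unique  = allZ (λ s v₀≡v → centre-off _ (trans (cong (d v₀) v₀≡v) (distance s)))
                  AllPairs.∷ concat-tabulate-unique L unique separated
      ; dists   = dists
      ; counts  = counts
      }

length-++-∸ : ∀ {A : Set} (u s : List A) {H h} → H ≤ h → length s ≡ h ∸ H → length (u ++ s) + H ≡ length u + h
length-++-∸ u s {H} {h} H≤h ∣s∣ = begin
  length (u ++ s) + H        ≡⟨ cong (_+ H) (length-++ u) ⟩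
  length u + length s + H    ≡⟨ +-assoc (length u) (length s) H ⟩
  length u + (length s + H)  ≡⟨ cong (λ l → length u + (l + H)) ∣s∣ ⟩
  length u + (h ∸ H + H)     ≡⟨ cong (length u +_) (m∸n+n≡m H≤h) ⟩
  length u + h               ∎
  where open ≡-Reasoning

≤-pred-+ : ∀ {e c R} r → e < r + c → pred r ≤ R → e ≤ R + c
≤-pred-+ {c = c} {R} zero    e<c    _     = ≤-trans (<⇒≤ e<c) (m≤n+m c R)
≤-pred-+ {c = c}     (suc r) e<r+c  r≤R   = ≤-trans (s≤s⁻¹ e<r+c) (+-monoˡ-≤ c r≤R)

sparseFork-arith : ∀ {e c Q Y} q D N R → e ≤ R + c → c * D ≤ Q * N → Y ≤ q * Q →
                   e * (D * q * Y) ≤ q * Q * (N * Y + R * D * q)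
sparseFork-arith {e} {c} {Q} {Y} q D N R e≤R+c cD≤QN Y≤qQ = begin
  e * (D * q * Y)                              ≤⟨ *-monoˡ-≤ (D * q * Y) e≤R+c ⟩
  (R + c) * (D * q * Y)                        ≡⟨ expand R c D q Y ⟩
  R * D * q * Y + c * D * (q * Y)              ≤⟨ +-monoʳ-≤ (R * D * q * Y) (*-monoˡ-≤ (q * Y) cD≤QN) ⟩
  R * D * q * Y + Q * N * (q * Y)              ≤⟨ +-monoˡ-≤ (Q * N * (q * Y)) (*-monoʳ-≤ (R * D * q) Y≤qQ) ⟩
  R * D * q * (q * Q) + Q * N * (q * Y)        ≡⟨ collect R D q Q N Y ⟩
  q * Q * (N * Y + R * D * q)                  ∎
  where
  open ≤-Reasoning
  expand : ∀ R c D q Y → (R + c) * (D * q * Y) ≡ R * D * q * Y + c * D * (q * Y)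
  expand = solve-∀
  collect : ∀ R D q Q N Y → R * D * q * (q * Q) + Q * N * (q * Y) ≡ q * Q * (N * Y + R * D * q)
  collect = solve-∀

stage-arith : ∀ {Q S Y} q R → 2 ≤ q → 1 ≤ Q → Q * S ≤ Y →
              (S + q * R * Q) * Y + R * (Q * S) * q ≤ (S + q * R * (q * Q)) * Y
stage-arith {Q} {S} {Y} q R 2≤q 1≤Q QS≤Y = begin
  (S + q * R * Q) * Y + R * (Q * S) * q  ≤⟨ +-monoʳ-≤ _ (*-monoˡ-≤ q (*-monoʳ-≤ R QS≤Y)) ⟩
  (S + q * R * Q) * Y + R * Y * q        ≤⟨ +-monoʳ-≤ _ (*-monoˡ-≤ q (*-monoʳ-≤ R Y≤QY)) ⟩
  (S + q * R * Q) * Y + R * (Q * Y) * q  ≡⟨ collect q Q S Y R ⟩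
  S * Y + 2 * (q * R * Q * Y)            ≤⟨ +-monoʳ-≤ (S * Y) (*-monoˡ-≤ (q * R * Q * Y) 2≤q) ⟩
  S * Y + q * (q * R * Q * Y)            ≡⟨ regroup q Q S Y R ⟩
  (S + q * R * (q * Q)) * Y              ∎
  where
  open ≤-Reasoning
  Y≤QY : Y ≤ Q * Y
  Y≤QY = subst (_≤ Q * Y) (*-identityˡ Y) (*-monoˡ-≤ Y 1≤Q)
  collect : ∀ q Q S Y R → (S + q * R * Q) * Y + R * (Q * Y) * q ≡ S * Y + 2 * (q * R * Q * Y)
  collect = solve-∀
  regroup : ∀ q Q S Y R → S * Y + q * (q * R * Q * Y) ≡ (S + q * R * (q * Q)) * Y
  regroup = solve-∀

final-arith : ∀ {c M L S R r} q .{{_ : NonZero q}} → R < r → 0 < M → 0 < L →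
              c * (L * (q * S)) ≤ M * (q * S + q * R * L) → c * (L * S) < M * (S + r * L)
final-arith {c} {M} {L} {S} {R} {r} q R<r 0<M 0<L bound = begin-strict
  c * (L * S)          ≤⟨ *-cancelˡ-≤ q (begin
      q * (c * (L * S))          ≡⟨ pull q c L S ⟩
      c * (L * (q * S))          ≤⟨ bound ⟩
      M * (q * S + q * R * L)    ≡⟨ push q M S R L ⟩
      q * (M * (S + R * L))      ∎) ⟩
  M * (S + R * L)      <⟨ *-monoʳ-< M {{>-nonZero 0<M}} (+-monoʳ-< S (*-monoˡ-< L {{>-nonZero 0<L}} R<r)) ⟩
  M * (S + r * L)      ∎
  where
  open ≤-Reasoning
  pull : ∀ q c L S → q * (c * (L * S)) ≡ c * (L * (q * S))
  pull = solve-∀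
  push : ∀ q M S R L → M * (q * S + q * R * L) ≡ q * (M * (S + R * L))
  push = solve-∀

module Branch {q : ℕ} (X : V q → Bool) (a : Fin (suc q)) where

  inX : List (Fin q) → Bool
  inX w = X (node a w)

  below : List (Fin q) → ℕ → ℕ
  below u h = countWords h (λ s → inX (u ++ s))

  below-children : ∀ u h → below u (suc h) ≡ sumFin (λ b → below (u ∷ʳ b) h)
  below-children u h = sumFin-cong λ b → countWords-cong h λ s _ → cong inX (sym (++-assoc u (b ∷ []) s))

  below-fork : ∀ A b h →
               below A (suc h) ≡ below (A ∷ʳ b) h + countWords (suc h) (λ z → inX (A ++ z) ∧ not (startsWith b z))
  below-fork A b h =
    trans (countWords-split (suc h) (λ z → inX (A ++ z)) (startsWith b))
          (cong (_+ countWords (suc h) (λ z → inX (A ++ z) ∧ not (startsWith b z)))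
                (trans (countWords-startsWith h b (λ z → inX (A ++ z)))
                              (countWords-cong h λ s _ → cong inX (sym (++-assoc A (b ∷ []) s)))))

  -- For w = A ++ b ∷ s with |s| = h, the X-vertices of w's level at distance 2 (h + 1) from w
  -- are the X-descendants of A at depth h + 1 outside A ∷ʳ b; Sparse says there are fewer than r.
  Sparse : ℕ → List (Fin q) → Fin q → ℕ → Set
  Sparse r A b h = below A (suc h) < r + below (A ∷ʳ b) h

  sparse? : ∀ r A b h → Dec (Sparse r A b h)
  sparse? r A b h = below A (suc h) <? r + below (A ∷ʳ b) h

  sparse⇒r>0 : ∀ {r A b h} → Sparse r A b h → 0 < r
  sparse⇒r>0 {zero}  {A} {b} {h} sparse = ⊥-elim (<⇒≱ sparse (begin
    below (A ∷ʳ b) h                      ≤⟨ ≤-sumFin (λ c → below (A ∷ʳ c) h) b ⟩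
    sumFin (λ c → below (A ∷ʳ c) h)       ≡⟨ below-children A h ⟨
    below A (suc h)                       ∎))
    where open ≤-Reasoning
  sparse⇒r>0 {suc r} _ = s≤s z≤n

  ThinAt : ℕ → ℕ → List (Fin q) → Set
  ThinAt r t w = Σ (Fork w t) λ f → let open Fork f in Sparse r stem branch (length tip)

  module _ {k} {t r : Fin k → ℕ} (t∈M : InM t) (w : List (Fin q)) (t≤∣w∣ : ∀ i → t i ≤ length w) where

    private
      forkAt : ∀ i → Fork w (t i)
      forkAt i = fork w (t i) (proj₁ t∈M i) (t≤∣w∣ i)

      SparseAt : Fin k → Set
      SparseAt i = let open Fork (forkAt i) in Sparse (r i) stem branch (length tip)

      offBranch : Fin k → List (Fin q) → Bool
      offBranch i z = let open Fork (forkAt i) in inX (stem ++ z) ∧ not (startsWith branch z)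

      ringCapacity : ∀ i → ¬ SparseAt i → r i ≤ countWords (t i) (offBranch i)
      ringCapacity i ¬sparse = subst (λ h → r i ≤ countWords h (offBranch i)) (sym height)
        (+-cancelʳ-≤ (below (stem ∷ʳ branch) (length tip)) (r i) _
          (subst (r i + below (stem ∷ʳ branch) (length tip) ≤_)
                 (trans (below-fork stem branch (length tip)) (+-comm (below (stem ∷ʳ branch) (length tip)) _))
                 (≮⇒≥ ¬sparse)))
        where open Fork (forkAt i)

      satellite : ∀ i {z} → z ∈ words (t i) (offBranch i) →
                  Satellite X t∈M (node a w) i (node a (Fork.stem (forkAt i) ++ z))
      satellite i z∈ with ∈-words⁻ (t i) (offBranch i) z∈
      satellite i {[]}     z∈ | ∣z∣ , _ = ⊥-elim (<-irrefl ∣z∣ (proj₁ t∈M i))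
      satellite i {c ∷ s′} z∈ | ∣z∣ , z∈offBranch
        with branch FinP.≟ c | ∧-conicalˡ (inX (stem ++ c ∷ s′)) _ z∈offBranch
                            | ∧-conicalʳ (inX (stem ++ c ∷ s′)) (not (startsWith branch (c ∷ s′))) z∈offBranch
        where open Fork (forkAt i)
      ... | yes _       | _   | ()
      ... | no branch≢c | z∈X | _ = record
        { distance = trans (cong (λ u → d (node a u) (node a (stem ++ c ∷ s′))) split)
                           (trans (d-fork a stem branch≢c ∣s′∣) (cong (2 *_) (sym height)))
        ; level    = cong suc (begin
            length (stem ++ c ∷ s′)       ≡⟨ length-++ stem ⟩
            length stem + suc (length s′) ≡⟨ cong (λ l → length stem + suc l) ∣s′∣ ⟩
            length stem + suc (length tip) ≡⟨ length-++ stem ⟨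
            length (stem ++ branch ∷ tip) ≡⟨ cong length split ⟨
            length w                       ∎)
        ; member   = z∈X
        }
        where
        open Fork (forkAt i)
        open ≡-Reasoning
        ∣s′∣ : length s′ ≡ length tip
        ∣s′∣ = suc-injective (trans ∣z∣ height)

      ring : Fin k → List (V q)
      ring i = take (r i) (map (λ z → node a (Fork.stem (forkAt i) ++ z)) (words (t i) (offBranch i)))

      ring-unique : ∀ i → Unique (ring i)
      ring-unique i = UniqueP.take⁺ (r i) (UniqueP.map⁺ (++-cancelˡ _ _ _ ∘ node-injective) (words-unique (t i) (offBranch i)))
        where
        node-injective : ∀ {x y} → node {q} a x ≡ node a y → x ≡ y
        node-injective refl = refl

      ring-size : ∀ i → ¬ SparseAt i → length (ring i) ≡ r i
      ring-size i ¬sparse = trans (length-take (r i) _) (m≤n⇒m⊓n≡m (begin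
        r i                                   ≤⟨ ringCapacity i ¬sparse ⟩
        countWords (t i) (offBranch i)        ≡⟨ length-words (t i) (offBranch i) ⟨
        length (words (t i) (offBranch i))    ≡⟨ length-map _ (words (t i) (offBranch i)) ⟨
        length (map _ (words (t i) (offBranch i))) ∎))
        where open ≤-Reasoning

    noBalancedStar⇒thin : ¬ ContainsBalancedStar X t r → inX w ≡ true → ∃ λ i → ThinAt (r i) (t i) w
    noBalancedStar⇒thin noStar w∈X with FinP.any? (λ i → let open Fork (forkAt i) in sparse? (r i) stem branch (length tip))
    ... | yes (i , sparse) = i , forkAt i , sparse
    ... | no ¬sparse = ⊥-elim (noStar (balancedStar X t∈M (node a w) w∈X ring
                                         (λ i → AllP.take⁺ (r i) (AllP.map⁺ (All.tabulate (satellite i))))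
                                         ring-unique (λ i → ring-size i (¬sparse ∘ (i ,_)))))

  below-blocks : ∀ h h′ u {D M} → (∀ s → length s ≡ h → below (u ++ s) h′ * D ≤ M) →
                 below u (h + h′) * D ≤ q ^ h * M
  below-blocks zero h′ u {D} {M} bound = begin
    below u h′ * D              ≡⟨ cong (_* D) (countWords-cong h′ λ s _ → cong inX (sym (++-assoc u [] s))) ⟩
    below (u ++ []) h′ * D      ≤⟨ bound [] refl ⟩
    M                           ≡⟨ *-identityˡ M ⟨
    1 * M                       ∎
    where open ≤-Reasoning
  below-blocks (suc h) h′ u {D} {M} bound = begin
    below u (suc h + h′) * D                          ≡⟨ cong (_* D) (below-children u (h + h′)) ⟩
    sumFin (λ b → below (u ∷ʳ b) (h + h′)) * D        ≡⟨ *-distribʳ-sumFin D (λ b → below (u ∷ʳ b) (h + h′)) ⟩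
    sumFin (λ b → below (u ∷ʳ b) (h + h′) * D)        ≤⟨ sumFin-≤-const (λ b → below-blocks h h′ (u ∷ʳ b) (child b)) ⟩
    q * (q ^ h * M)                                   ≡⟨ *-assoc q (q ^ h) M ⟨
    q ^ suc h * M                                     ∎
    where
    open ≤-Reasoning
    child : ∀ b s → length s ≡ h → below ((u ∷ʳ b) ++ s) h′ * D ≤ M
    child b s ∣s∣ = subst (λ v → below v h′ * D ≤ M) (sym (++-assoc u (b ∷ []) s)) (bound (b ∷ s) (cong suc ∣s∣))

  below-scale-up : ∀ u {H h D N} → H ≤ h →
                   (∀ s → length s ≡ h ∸ H → below (u ++ s) H * D ≤ q ^ H * N) → below u h * D ≤ q ^ h * N
  below-scale-up u {H} {h} {D} {N} H≤h bound = begin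
    below u h * D                      ≡⟨ cong (λ l → below u l * D) h∸H+H ⟨
    below u (h ∸ H + H) * D            ≤⟨ below-blocks (h ∸ H) H u bound ⟩
    q ^ (h ∸ H) * (q ^ H * N)          ≡⟨ *-assoc (q ^ (h ∸ H)) (q ^ H) N ⟨
    q ^ (h ∸ H) * q ^ H * N            ≡⟨ cong (_* N) (^-distribˡ-+-* q (h ∸ H) H) ⟨
    q ^ (h ∸ H + H) * N                ≡⟨ cong (λ l → q ^ l * N) h∸H+H ⟩
    q ^ h * N                          ∎
    where
    open ≤-Reasoning
    h∸H+H : h ∸ H + H ≡ h
    h∸H+H = m∸n+n≡m H≤h

  thin⇒sparse : ∀ {r h} A s → length s ≡ suc h → ThinAt r (suc h) (A ++ s) → ∃ λ b → Sparse r A b h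
  thin⇒sparse {r} A s ∣s∣ (f , sparse) =
    branch , subst₂ (λ B l → Sparse r B branch l) (fork-stem A s f ∣s∣) (suc-injective (sym height)) sparse
    where open Fork f

  -- The density of X among the level-m descendants of any vertex of height h ≥ H is at most N / D.
  DensityBound : ℕ → ℕ → ℕ → ℕ → Set
  DensityBound m H D N = ∀ u h → length u + h ≡ m → H ≤ h → below u h * D ≤ q ^ h * N

  densityBound-fromHeight : ∀ {m H D N} → (∀ u → length u + H ≡ m → below u H * D ≤ q ^ H * N) → DensityBound m H D N
  densityBound-fromHeight bound u h ∣u∣+h H≤h =
    below-scale-up u H≤h λ s ∣s∣ → bound (u ++ s) (trans (length-++-∸ u s H≤h ∣s∣) ∣u∣+h)

  module _ {{_ : NonZero q}} {m k} {t r : Fin (suc k) → ℕ} (t∈M : InM t) {R} (pred-r≤R : ∀ i → pred (r i) ≤ R)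
           (allThin : ∀ w → length w ≡ m → inX w ≡ true → ∃ λ i → ThinAt (r i) (t i) w)
           {H D N} (H<t₀ : H < t zero) (bound : DensityBound m H D N) where

    private
      Y N₁ : ℕ
      Y  = q ^ t zero
      N₁ = N * Y + R * D * q

      ThinBelow : Fin (suc k) → List (Fin q) → Set
      ThinBelow i A = ∀ s → length s ≡ t i → inX (A ++ s) ≡ true → ∃ λ j → j Fin.≤ i × ThinAt (r j) (t j) (A ++ s)

      ScaleGoal : Fin (suc k) → List (Fin q) → Set
      ScaleGoal i A = below A (t i) * (D * q * Y) ≤ q ^ t i * N₁

      NoSparseFork : Fin (suc k) → List (Fin q) → Set
      NoSparseFork i A = ∀ b → ¬ Sparse (r i) A b (pred (t i))

      t≡suc : ∀ i → t i ≡ suc (pred (t i))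
      t≡suc i = sym (suc-pred (t i) {{>-nonZero (proj₁ t∈M i)}})

      notThin : ∀ {i A} → NoSparseFork i A → ∀ s → length s ≡ t i → ¬ ThinAt (r i) (t i) (A ++ s)
      notThin {i} {A} noFork s ∣s∣ thin =
        let b , sparse = thin⇒sparse A s (trans ∣s∣ (t≡suc i)) (subst (λ l → ThinAt (r i) l (A ++ s)) (t≡suc i) thin)
        in noFork b sparse

      sparseFork-bound : ∀ i A b → length A + t i ≡ m → Sparse (r i) A b (pred (t i)) → ScaleGoal i A
      sparseFork-bound i A b ∣A∣ sparse =
        subst (λ l → below A l * (D * q * Y) ≤ q ^ l * N₁) (sym (t≡suc i))
              (sparseFork-arith q D N R (≤-pred-+ (r i) sparse (pred-r≤R i)) (bound (A ∷ʳ b) h ∣A∷b∣ H≤h) Y≤)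
        where
        h = pred (t i)
        ∣A∷b∣ : length (A ∷ʳ b) + h ≡ m
        ∣A∷b∣ = trans (cong (_+ h) (length-++ A))
                      (trans (+-assoc (length A) 1 h) (trans (cong (length A +_) (sym (t≡suc i))) ∣A∣))
        t₀≤ : t zero ≤ suc h
        t₀≤ = subst (t zero ≤_) (t≡suc i) (InM-mono t∈M {zero} {i} z≤n)
        H≤h : H ≤ h
        H≤h = s≤s⁻¹ (≤-trans H<t₀ t₀≤)
        Y≤ : Y ≤ q * q ^ h
        Y≤ = ^-monoʳ-≤ q t₀≤

      byForks : ∀ i A → length A + t i ≡ m → (NoSparseFork i A → ScaleGoal i A) → ScaleGoal i A
      byForks i A ∣A∣ noForkGoal with FinP.any? (λ b → sparse? (r i) A b (pred (t i)))
      ... | yes (b , sparse) = sparseFork-bound i A b ∣A∣ sparse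
      ... | no ¬sparse       = noForkGoal (λ b → ¬sparse ∘ (b ,_))

      ScaleBound : Fin (suc k) → Set
      ScaleBound i = ∀ A → length A + t i ≡ m → ThinBelow i A → ScaleGoal i A

      scaleBound-zero : ScaleBound zero
      scaleBound-zero A ∣A∣ thin = byForks zero A ∣A∣ λ noFork →
        subst (λ e → e * (D * q * Y) ≤ q ^ t zero * N₁) (sym (empty noFork)) z≤n
        where
        empty : NoSparseFork zero A → below A (t zero) ≡ 0
        empty noFork = countWords-none (t zero) λ s ∣s∣ → ¬-not λ s∈X → case thin s ∣s∣ s∈X of λ where
          (zero  , _  , th) → notThin noFork s ∣s∣ th

      t-inject₁≤t-suc : ∀ j → t (inject₁ j) ≤ t (suc j)
      t-inject₁≤t-suc j = InM-mono t∈M (<⇒≤ (FinP.≤̄⇒inject₁< {i = j} ≤-refl))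

      length-gap : ∀ j {s s₂ : List (Fin q)} → length s ≡ t (suc j) ∸ t (inject₁ j) → length s₂ ≡ t (inject₁ j) →
                   length (s ++ s₂) ≡ t (suc j)
      length-gap j {s} ∣s∣ ∣s₂∣ = trans (length-++ s) (trans (cong₂ _+_ ∣s∣ ∣s₂∣) (m∸n+n≡m (t-inject₁≤t-suc j)))

      thinBelow-inject : ∀ j A → NoSparseFork (suc j) A → ThinBelow (suc j) A →
                         ∀ s → length s ≡ t (suc j) ∸ t (inject₁ j) → ThinBelow (inject₁ j) (A ++ s)
      thinBelow-inject j A noFork thin s ∣s∣ s₂ ∣s₂∣ s∈X
        with thin (s ++ s₂) (length-gap j {s} {s₂} ∣s∣ ∣s₂∣) (subst (λ v → inX v ≡ true) (++-assoc A s s₂) s∈X)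
      ... | j″ , j″≤ , th with j″ FinP.≟ suc j
      ...   | yes refl = ⊥-elim (notThin noFork (s ++ s₂) (length-gap j {s} {s₂} ∣s∣ ∣s₂∣) th)
      ...   | no j″≢   = j″ , FinP.<⇒≤pred (FinP.≤∧≢⇒< j″≤ j″≢) ,
                         subst (ThinAt (r j″) (t j″)) (sym (++-assoc A s s₂)) th

      scaleBound-suc : ∀ j → ScaleBound (inject₁ j) → ScaleBound (suc j)
      scaleBound-suc j ih A ∣A∣ thin = byForks (suc j) A ∣A∣ λ noFork →
        below-scale-up A (t-inject₁≤t-suc j) λ s ∣s∣ →
          ih (A ++ s) (trans (length-++-∸ A s (t-inject₁≤t-suc j) ∣s∣) ∣A∣) (thinBelow-inject j A noFork thin s ∣s∣)

      scaleBound : ∀ i → ScaleBound i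
      scaleBound = <-weakInduction ScaleBound scaleBound-zero scaleBound-suc

    -- Below a sparse fork the subtree has at most R more X-leaves than one child subtree, of
    -- density ≤ N / D; without one it splits into blocks of the next smaller scale.  Either way
    -- the density bound improves to N / (D q) + R / q ^ t zero.
    densityStep : ∀ {N′} → N * q ^ t zero + R * D * q ≤ N′ * q ^ t zero → DensityBound m (t (fromℕ k)) (D * q) N′
    densityStep {N′} N₁≤N′Y = densityBound-fromHeight λ A ∣A∣ → *-cancelʳ-≤ _ _ Y {{m^n≢0 q (t zero)}} (begin
      below A T * (D * q) * Y      ≡⟨ *-assoc (below A T) (D * q) Y ⟩
      below A T * (D * q * Y)      ≤⟨ scaleBound (fromℕ k) A ∣A∣ (thinEverywhere A ∣A∣) ⟩
      q ^ T * N₁                   ≤⟨ *-monoʳ-≤ (q ^ T) N₁≤N′Y ⟩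
      q ^ T * (N′ * Y)             ≡⟨ *-assoc (q ^ T) N′ Y ⟨
      q ^ T * N′ * Y               ∎)
      where
      open ≤-Reasoning
      T = t (fromℕ k)
      thinEverywhere : ∀ A → length A + T ≡ m → ThinBelow (fromℕ k) A
      thinEverywhere A ∣A∣ s ∣s∣ s∈X =
        let j , th = allThin (A ++ s) (trans (length-++ A) (trans (cong (length A +_) ∣s∣) ∣A∣)) s∈X
        in j , FinP.≤fromℕ j , th

module _ {q} {{_ : NonZero q}} (2≤q : 2 ≤ q) (X : V q → Bool) {k′ ℓ′} {r : Fin (suc k′) → ℕ}
         {ts : Fin (suc ℓ′) → Fin (suc k′) → ℕ} (ts∈M : ∀ j → InM (ts j))
         (chain : ∀ (j : Fin ℓ′) → ts (inject₁ j) (fromℕ k′) < ts (suc j) zero)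
         (noStar : ∀ j → ¬ ContainsBalancedStar X (ts j) r)
         (a : Fin (suc q)) {m} (T<n : ts (fromℕ ℓ′) (fromℕ k′) < suc m) where

  open Branch X a

  private
    T : Fin (suc ℓ′) → ℕ
    T j = ts j (fromℕ k′)

    s R : ℕ
    s = ts zero zero
    R = pred (maxFin r)

    T≤T-last : ∀ j → T j ≤ T (fromℕ ℓ′)
    T≤T-last = >-weakInduction (λ j → T j ≤ T (fromℕ ℓ′)) ≤-refl λ j T-suc≤ →
      ≤-trans (<⇒≤ (chain j)) (≤-trans (InM-mono (ts∈M (suc j)) z≤n) T-suc≤)

    ts≤m : ∀ j i → ts j i ≤ m
    ts≤m j i = ≤-trans (InM-mono (ts∈M j) (FinP.≤fromℕ i)) (≤-trans (T≤T-last j) (s≤s⁻¹ T<n))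

    allThin : ∀ j w → length w ≡ m → inX w ≡ true → ∃ λ i → ThinAt (r i) (ts j i) w
    allThin j w ∣w∣ = noBalancedStar⇒thin (ts∈M j) w (λ i → subst (ts j i ≤_) (sym ∣w∣) (ts≤m j i)) (noStar j)

    -- density at most q ^ -(p + 1) + R q ^ (1 - s) from height T j on
    Stage : ℕ → Fin (suc ℓ′) → Set
    Stage p j = DensityBound m (T j) (q ^ suc p * q ^ s) (q ^ s + q * R * q ^ suc p) × s + p ≤ ts j zero

    stage : ∀ {p H} j → DensityBound m H (q ^ p * q ^ s) (q ^ s + q * R * q ^ p) →
            H < ts j zero → s + p ≤ ts j zero → Stage p j
    stage {p} j bound H<tⱼ s+p≤tⱼ =
      subst (λ D → DensityBound m (T j) D (q ^ s + q * R * q ^ suc p)) (regroup q (q ^ p) (q ^ s))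
            (densityStep (ts∈M j) (λ i → pred-mono-≤ (≤-maxFin r i)) (allThin j) H<tⱼ bound
                         (stage-arith q R 2≤q (m^n>0 q p) (begin
                            q ^ p * q ^ s      ≡⟨ ^-distribˡ-+-* q p s ⟨
                            q ^ (p + s)        ≤⟨ ^-monoʳ-≤ q (≤-trans (≤-reflexive (+-comm p s)) s+p≤tⱼ) ⟩
                            q ^ ts j zero      ∎))) ,
      s+p≤tⱼ
      where
      open ≤-Reasoning
      regroup : ∀ q x y → x * y * q ≡ q * x * y
      regroup = solve-∀

    stages : ∀ j → Stage (toℕ j) j
    stages = <-weakInduction (λ j → Stage (toℕ j) j) first λ j prev →
      let bound , s+j≤ = subst (λ p → Stage p (inject₁ j)) (FinP.toℕ-inject₁ j) prev
      in stage (suc j) bound (chain j)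
           (subst (_≤ ts (suc j) zero) (sym (+-suc s (toℕ j)))
                  (≤-trans (s≤s (≤-trans s+j≤ (InM-mono (ts∈M (inject₁ j)) z≤n))) (chain j)))
      where
      first : Stage 0 zero
      first = stage zero (λ u h _ _ → *-mono-≤ (countWords-≤ h _)
                                                (≤-trans (≤-reflexive (*-identityˡ (q ^ s))) (m≤m+n (q ^ s) _)))
                    (proj₁ (ts∈M zero) zero) (≤-reflexive (+-identityʳ s))

    noWords : maxFin r ≡ 0 → countWords m inX ≡ 0
    noWords rmax≡0 = countWords-none m λ w ∣w∣ → ¬-not λ w∈X →
      let i , f , sparse = allThin zero w ∣w∣ w∈X
          open Fork f
      in <⇒≱ (sparse⇒r>0 {r i} {stem} {branch} {length tip} sparse) (subst (r i ≤_) rmax≡0 (≤-maxFin r i))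

    levelBound : countWords m inX * (q ^ suc ℓ′ * q ^ s) ≤ q ^ m * (q ^ s + q * R * q ^ suc ℓ′)
    levelBound = proj₁ (subst (λ p → Stage p (fromℕ ℓ′)) (FinP.toℕ-fromℕ ℓ′) (stages (fromℕ ℓ′))) [] m refl (s≤s⁻¹ T<n)

    q^s : q ^ s ≡ q * q ^ (s ∸ 1)
    q^s = cong (q ^_) (sym (suc-pred s {{>-nonZero (proj₁ (ts∈M zero) zero)}}))

  branchBound : countWords m inX * (q ^ suc ℓ′ * q ^ (s ∸ 1)) < q ^ m * (q ^ (s ∸ 1) + maxFin r * q ^ suc ℓ′)
  branchBound with maxFin r ≟ 0
  ... | yes rmax≡0 rewrite noWords rmax≡0 =
    subst (_< q ^ m * (q ^ (s ∸ 1) + maxFin r * q ^ suc ℓ′)) (*-zeroʳ (q ^ m))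
          (*-monoʳ-< (q ^ m) {{m^n≢0 q m}} (<-≤-trans (m^n>0 q (s ∸ 1)) (m≤m+n _ _)))
  ... | no rmax≢0 =
    final-arith {countWords m inX} q (≤-reflexive (suc-pred (maxFin r) {{≢-nonZero rmax≢0}})) (m^n>0 q m) (m^n>0 q (suc ℓ′))
                (subst (λ x → countWords m inX * (q ^ suc ℓ′ * x) ≤ q ^ m * (x + q * R * q ^ suc ℓ′)) q^s levelBound)

lemma1p5 : (q : ℕ) → 2 ≤ q → (X : V q → Bool) → (k′ ℓ′ : ℕ)
    → (r : Fin (suc k′) → ℕ) → (ts : Fin (suc ℓ′) → Fin (suc k′) → ℕ)
    → (∀ j → InM (ts j))
    → (∀ (j : Fin ℓ′) → ts (inject₁ j) (fromℕ k′) < ts (suc j) zero)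
    → (∀ j → ¬ ContainsBalancedStar X (ts j) r)
    → ∀ n → ts (fromℕ ℓ′) (fromℕ k′) < n
    → sphereCount X n * (q ^ suc ℓ′ * q ^ (ts zero zero ∸ 1))
      < sphereSize q n * (q ^ (ts zero zero ∸ 1) + maxFin r * q ^ suc ℓ′)
lemma1p5 (suc zero) (s≤s ()) _ _ _ _ _ _ _ _ _ _
lemma1p5 _ _ _ _ _ _ _ _ _ _ zero ()
lemma1p5 q@(suc (suc _)) 2≤q X k′ ℓ′ r ts ts∈M chain noStar (suc m) T<n = begin-strict
  sphereCount X (suc m) * F                          ≡⟨ *-distribʳ-sumFin F (λ a → countWords m (λ w → X (node a w))) ⟩
  sumFin (λ a → countWords m (λ w → X (node a w)) * F)
    <⟨ sumFin-mono-< (λ a → branchBound 2≤q X ts∈M chain noStar a T<n) ⟩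
  sumFin {suc q} (λ _ → q ^ m * G)                   ≡⟨ sumFin-cong {suc q} (λ _ → cong (_* G) (countWords-all {q} m)) ⟨
  sumFin {suc q} (λ _ → countWords {q} m (λ _ → true) * G)
                                                     ≡⟨ *-distribʳ-sumFin {suc q} G (λ _ → countWords {q} m (λ _ → true)) ⟨
  sphereSize q (suc m) * G                           ∎
  where
  open ≤-Reasoning
  F = q ^ suc ℓ′ * q ^ (ts zero zero ∸ 1)
  G = q ^ (ts zero zero ∸ 1) + maxFin r * q ^ suc ℓ′
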